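{- For every $n\ge 3$, the number of alternating permutations $\sigma\in A_n$ satisfying $\sigma_2>\sigma_3+1>\sigma_1+1$ equals $n!$ times the coefficient of $x^n$ in $$(2-x)(\sec x+\tan x)-\int_0^x (t-1)(\sec t+\tan t)\,dt.$$
   Context: A permutation $\sigma$ of $\{1,\dots,n\}$ is alternating if $\sigma_1<\sigma_2>\sigma_3<\sigma_4>\cdots$; $A_n$ is the set of such permutations. -}

module Defs where

open import Data.Nat as ℕ using (ℕ; zero; suc; _<_; _>_; _!)
open import Data.Nat.Properties using (_<?_; _!≢0)
open import Data.Integer as ℤ using (ℤ)
open import Data.Rational as ℚ using (ℚ; 0ℚ; 1ℚ; _+_; _*_; -_; _-_)
open import Data.List as L using (List; []; _∷_; concatMap; map; length; filter)
open import Data.List.Relation.Unary.Unique.Propositional using (Unique)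
open import Data.List.Relation.Unary.Unique.DecPropositional ℕ._≟_ using (unique?)
open import Data.Vec as V using (Vec; []; _∷_)
open import Data.Fin using (Fin; toℕ)
open import Data.Product using (_×_; _,_)
open import Data.Product.Relation.Unary.All using ()
open import Data.Unit using (⊤; tt)
open import Data.Empty using (⊥)
open import Relation.Nullary using (Dec; yes; no)
open import Relation.Nullary.Decidable using (_×-dec_)

-- Permutations of {1,…,n}, written in one-line notation σ₁ σ₂ … σₙ as
-- lists of naturals.

seqs : ℕ → ℕ → List (List ℕ)
seqs n zero    = [] ∷ []
seqs n (suc k) = concatMap (λ i → map (suc i ∷_) (seqs n k)) (L.upTo n)

-- a list of length n with entries in {1,…,n} and pairwise distinct
-- entries is exactly a permutation of {1,…,n} in one-line notation
-- (Unique below); so the permutations are these: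
--   filter unique? (seqs n n)

mutual
  Up : List ℕ → Set
  Up (a ∷ b ∷ r) = a < b × Down (b ∷ r)
  Up _           = ⊤

  Down : List ℕ → Set
  Down (a ∷ b ∷ r) = a > b × Up (b ∷ r)
  Down _           = ⊤

Alternating : List ℕ → Set
Alternating = Up

mutual
  up? : (xs : List ℕ) → Dec (Up xs)
  up? []          = yes tt
  up? (a ∷ [])    = yes tt
  up? (a ∷ b ∷ r) = (a <? b) ×-dec down? (b ∷ r)

  down? : (xs : List ℕ) → Dec (Down xs)
  down? []          = yes tt
  down? (a ∷ [])    = yes tt
  down? (a ∷ b ∷ r) = (b <? a) ×-dec up? (b ∷ r)

alternating? : (xs : List ℕ) → Dec (Alternating xs)
alternating? = up?

Cond : List ℕ → Set
Cond (a ∷ b ∷ c ∷ _) = (b > c ℕ.+ 1) × (c ℕ.+ 1 > a ℕ.+ 1)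
Cond _               = ⊥

cond? : (xs : List ℕ) → Dec (Cond xs)
cond? []              = no λ ()
cond? (a ∷ [])        = no λ ()
cond? (a ∷ b ∷ [])    = no λ ()
cond? (a ∷ b ∷ c ∷ _) = (c ℕ.+ 1 <? b) ×-dec (a ℕ.+ 1 <? c ℕ.+ 1)

countA : ℕ → ℕ
countA n = length (filter (λ σ → unique? σ ×-dec (alternating? σ ×-dec cond? σ)) (seqs n n))

PS : Set
PS = ℕ → ℚ

coeff : ℕ → PS → ℚ
coeff n f = f n

const : ℚ → PS
const c zero    = c
const c (suc n) = 0ℚ

X : PS
X 1 = 1ℚ
X _ = 0ℚ

_⊕_ : PS → PS → PS
(f ⊕ g) n = f n + g n

_⊖_ : PS → PS → PS
(f ⊖ g) n = f n - g n

sumVec : ∀ {m} → Vec ℚ m → ℚ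
sumVec = V.foldr _ _+_ 0ℚ

_⊗_ : PS → PS → PS
(f ⊗ g) n = sumVec (V.tabulate {n = suc n} (λ (k : Fin (suc n)) → f (toℕ k) * g (n ℕ.∸ toℕ k)))

invFact : ℕ → ℚ
invFact k = ℤ.+ 1 ℚ./ (k !)
  where instance _ = k !≢0

cosPS : PS
cosPS n = go n n
  where
  -- sign (-1)^(n/2) for n even, 0 for n odd
  go : ℕ → ℕ → ℚ
  go zero          k = invFact k
  go (suc zero)    k = 0ℚ
  go (suc (suc m)) k = - go m k

sinPS : PS
sinPS n = go n n
  where
  go : ℕ → ℕ → ℚ
  go zero          k = 0ℚ
  go (suc zero)    k = invFact k
  go (suc (suc m)) k = - go m k

-- multiplicative inverse of a power series with constant term 1:
-- b₀ = 1, b_{m} = - Σ_{j=1}^{m} f j * b_{m-j}.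
-- invRev f n = (b_n, b_{n-1}, …, b_0)
invRev : PS → (n : ℕ) → Vec ℚ (suc n)
invRev f zero    = 1ℚ ∷ []
invRev f (suc n) = (- sumVec (V.zipWith _*_ (V.tabulate (λ (j : Fin (suc n)) → f (suc (toℕ j)))) prev)) ∷ prev
  where prev = invRev f n

inv₁ : PS → PS
inv₁ f n = V.head (invRev f n)

secPS : PS
secPS = inv₁ cosPS

tanPS : PS
tanPS = sinPS ⊗ secPS

integral : PS → PS
integral f zero    = 0ℚ
integral f (suc n) = f n * (ℤ.+ 1 ℚ./ suc n)

F : PS
F = ((const (ℤ.+ 2 ℚ./ 1) ⊖ X) ⊗ (secPS ⊕ tanPS))
    ⊖ integral ((X ⊖ const 1ℚ) ⊗ (secPS ⊕ tanPS))

{-# OPTIONS --safe #-}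

-- Decomposing σ ∈ A_{m+3} by its first three entries and standardising the rest, the condition
-- σ₂ > σ₃ + 1 > σ₁ + 1 contributes a factor (l+1)(m−l) when σ₃ has relative rank l + 1, so the
-- count is Σ_{l ≤ m} (l+1)(m−l)·e(m, m−l), where the Entringer number e(m, m−l) counts the alternating
-- continuations ρ of [m] with l < ρ₁. Summing the Entringer recurrence
-- e(n+1, k+1) = e(n+1, k) + e(n, n−k) twice expresses this through the diagonal E_n = e(n, n)
-- as 2E_{m+3} − (m+2)E_{m+2} − (m+2)E_{m+1}. On the other side,
-- e(n, k) = Σᵢ (C(k,i) sin⁽ⁱ⁾(0) + C(n−k,i) cos⁽ⁱ⁾(0))·S_{n−i}, with S_j = j!·[xʲ] sec x,
-- satisfies the recurrence by Pascal's rule, vanishes at k = 0 because cos·sec = 1, and has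
-- diagonal n!·[xⁿ](sec x + tan x) because sin·sec = tan. Finally, n! times the coefficient
-- of xⁿ in the given series is 2E_n − (n−1)E_{n−1} − (n−1)E_{n−2}.

module Submission where

open import Algebra.Bundles using (CommutativeMonoid; CommutativeSemiring; CommutativeRing)
open import Data.Bool.Base using (Bool; true; false; if_then_else_; _∧_; not)
open import Data.Nat.Base as ℕ using (ℕ; zero; suc; _∸_; _!; _<ᵇ_; _≡ᵇ_; _≥_)
import Data.Nat.Properties as NP

module FiniteSum {c ℓ} (R : CommutativeSemiring c ℓ) where

  open CommutativeSemiring R
  open import Algebra.Properties.CommutativeSemigroup +-commutativeSemigroup using (interchange)
  open import Relation.Binary.Reasoning.Setoid setoid

  ∑ : ℕ → (ℕ → Carrier) → Carrier
  ∑ zero    f = 0#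
  ∑ (suc n) f = f 0 + ∑ n (λ i → f (suc i))

  ∑-cong : ∀ n {f g : ℕ → Carrier} → (∀ i → i ℕ.< n → f i ≈ g i) → ∑ n f ≈ ∑ n g
  ∑-cong zero    f≈g = refl
  ∑-cong (suc n) f≈g = +-cong (f≈g 0 ℕ.z<s) (∑-cong n (λ i i<n → f≈g (suc i) (ℕ.s<s i<n)))

  ∑-zero : ∀ n → ∑ n (λ _ → 0#) ≈ 0#
  ∑-zero zero    = refl
  ∑-zero (suc n) = trans (+-identityˡ _) (∑-zero n)

  ∑-+ : ∀ n (f g : ℕ → Carrier) → ∑ n (λ i → f i + g i) ≈ ∑ n f + ∑ n g
  ∑-+ zero    f g = sym (+-identityˡ 0#)
  ∑-+ (suc n) f g = trans (+-congˡ (∑-+ n (λ i → f (suc i)) (λ i → g (suc i)))) (interchange _ _ _ _)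

  ∑-*ˡ : ∀ n x (f : ℕ → Carrier) → ∑ n (λ i → x * f i) ≈ x * ∑ n f
  ∑-*ˡ zero    x f = sym (zeroʳ x)
  ∑-*ˡ (suc n) x f = trans (+-congˡ (∑-*ˡ n x (λ i → f (suc i)))) (sym (distribˡ x _ _))

  ∑-last : ∀ n (f : ℕ → Carrier) → ∑ (suc n) f ≈ ∑ n f + f n
  ∑-last zero    f = trans (+-identityʳ (f 0)) (sym (+-identityˡ (f 0)))
  ∑-last (suc n) f = trans (+-congˡ (∑-last n (λ i → f (suc i)))) (sym (+-assoc _ _ _))

  ∑-reverse : ∀ n (f : ℕ → Carrier) → ∑ n (λ i → f (n ∸ suc i)) ≈ ∑ n f
  ∑-reverse zero    f = refl
  ∑-reverse (suc n) f = begin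
    f n + ∑ n (λ i → f (n ∸ suc i))  ≈⟨ +-congˡ (∑-reverse n f) ⟩
    f n + ∑ n f                      ≈⟨ +-comm _ _ ⟩
    ∑ n f + f n                      ≈⟨ ∑-last n f ⟨
    ∑ (suc n) f                      ∎

  ∑-swap : ∀ m n (f : ℕ → ℕ → Carrier) →
           ∑ m (λ i → ∑ n (λ j → f i j)) ≈ ∑ n (λ j → ∑ m (λ i → f i j))
  ∑-swap zero    n f = sym (∑-zero n)
  ∑-swap (suc m) n f = trans (+-congˡ (∑-swap m n (λ i → f (suc i))))
                             (sym (∑-+ n (f 0) (λ j → ∑ m (λ i → f (suc i) j))))

  ∑-prefix : ∀ N y (f : ℕ → Carrier) → y ℕ.≤ N →
             ∑ N (λ i → if i <ᵇ y then f i else 0#) ≈ ∑ y f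
  ∑-prefix N       zero    f _         = ∑-zero N
  ∑-prefix (suc N) (suc y) f (ℕ.s≤s y≤N) = +-congˡ (∑-prefix N y (λ i → f (suc i)) y≤N)

  ∑-suffix : ∀ N x (f : ℕ → Carrier) → x ℕ.≤ N →
             ∑ N (λ i → if x <ᵇ suc i then f i else 0#) ≈ ∑ (N ∸ x) (λ t → f (x ℕ.+ t))
  ∑-suffix N       zero    f _           = refl
  ∑-suffix (suc N) (suc x) f (ℕ.s≤s x≤N) = trans (+-identityˡ _) (∑-suffix N x (λ i → f (suc i)) x≤N)

  ∑-if : ∀ n b (f : ℕ → Carrier) → ∑ n (λ i → if b then f i else 0#) ≈ (if b then ∑ n f else 0#)
  ∑-if n true  f = refl
  ∑-if n false f = ∑-zero n

open import Data.Bool.Properties using (∧-assoc; ∧-zeroʳ; ∧-identityʳ; ∧-commutativeMonoid)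
open import Data.Fin.Base as Fin using (Fin; toℕ)
import Data.Integer.Base as ℤ
import Data.Integer.Properties as ZP
open import Data.List.Base using (List; []; _∷_; _++_; map; concatMap; applyUpTo; filter; length)
open import Data.List.Relation.Unary.All using (all?)
open import Data.List.Relation.Unary.Unique.DecPropositional NP._≟_ using (unique?)
open import Data.Nat.Combinatorics using (_C_; nCk≡n!/k![n-k]!; k![n∸k]!∣n!; nCk+nC[k+1]≡[n+1]C[k+1])
open import Data.Nat.Coprimality using (Coprime; 1-coprimeTo) renaming (sym to Coprime-sym)
open import Data.Nat.DivMod using (m/n*n≡m)
open import Data.Nat.Properties using (_≤?_; _<?_; _!≢0; _!*_!≢0)
open import Data.Rational.Base using (ℚ; mkℚ; 0ℚ; 1ℚ; _+_; _*_; -_; _-_; _/_)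
import Data.Rational.Properties as QP
open import Data.Rational.Solver using (module +-*-Solver)
open import Data.Vec.Base as V using (Vec; []; _∷_)
open import Function.Base using (id; _∘_)
open import Relation.Binary.PropositionalEquality using (_≡_; refl; sym; trans; cong; cong₂; module ≡-Reasoning)
open import Relation.Nullary.Decidable using (does; yes; no; ¬?; _×-dec_)
open import Relation.Unary using (Decidable)
open import Algebra.Properties.CommutativeSemigroup (CommutativeMonoid.commutativeSemigroup ∧-commutativeMonoid)
  using (xy∙z≈xz∙y; x∙yz≈y∙xz)

open import Defs

open +-*-Solver
open ≡-Reasoning

module ℕ∑ = FiniteSum NP.+-*-commutativeSemiring
open FiniteSum (CommutativeRing.commutativeSemiring QP.+-*-commutativeRing)

∑-neg : ∀ n (f : ℕ → ℚ) → ∑ n (λ i → - f i) ≡ - ∑ n f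
∑-neg zero    f = refl
∑-neg (suc n) f = trans (cong (- f 0 +_) (∑-neg n (λ i → f (suc i)))) (sym (QP.neg-distrib-+ (f 0) _))

∑-- : ∀ n (f g : ℕ → ℚ) → ∑ n (λ i → f i - g i) ≡ ∑ n f - ∑ n g
∑-- n f g = trans (∑-+ n f (λ i → - g i)) (cong (∑ n f +_) (∑-neg n g))

-- Recursive rather than + n / 1, so that ι (suc n) unfolds to 1ℚ + ι n for the ring solver.
ι : ℕ → ℚ
ι zero    = 0ℚ
ι (suc n) = 1ℚ + ι n

ι-+ : ∀ a b → ι (a ℕ.+ b) ≡ ι a + ι b
ι-+ zero    b = sym (QP.+-identityˡ (ι b))
ι-+ (suc a) b = trans (cong (1ℚ +_) (ι-+ a b)) (sym (QP.+-assoc 1ℚ (ι a) (ι b)))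

ι-* : ∀ a b → ι (a ℕ.* b) ≡ ι a * ι b
ι-* zero    b = sym (QP.*-zeroˡ (ι b))
ι-* (suc a) b = begin
  ι (b ℕ.+ a ℕ.* b)   ≡⟨ ι-+ b (a ℕ.* b) ⟩
  ι b + ι (a ℕ.* b)   ≡⟨ cong (ι b +_) (ι-* a b) ⟩
  ι b + ι a * ι b     ≡⟨ solve 2 (λ x y → y :+ x :* y := (con 1ℚ :+ x) :* y) refl (ι a) (ι b) ⟩
  ι (suc a) * ι b     ∎

/1≡mkℚ : ∀ k → ℤ.+ k / 1 ≡ mkℚ (ℤ.+ k) 0 (Coprime-sym (1-coprimeTo k))
/1≡mkℚ k = QP.normalize-coprime (Coprime-sym (1-coprimeTo k))

ι≡/1 : ∀ n → ι n ≡ ℤ.+ n / 1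
ι≡/1 zero    = refl
ι≡/1 (suc n) = begin
  1ℚ + ι n
    ≡⟨ cong (1ℚ +_) (trans (ι≡/1 n) (/1≡mkℚ n)) ⟩
  1ℚ + mkℚ (ℤ.+ n) 0 (Coprime-sym (1-coprimeTo n))
    ≡⟨ QP./-cong (cong (ℤ._+_ (ℤ.+ 1)) (ZP.*-identityʳ (ℤ.+ n))) refl ⟩
  ℤ.+ suc n / 1 ∎

ι-*-inverse : ∀ d .{{_ : ℕ.NonZero d}} → ι d * (ℤ.+ 1 / d) ≡ 1ℚ
ι-*-inverse (suc d) = begin
  ι (suc d) * (ℤ.+ 1 / suc d)   ≡⟨ cong₂ _*_ (trans (ι≡/1 (suc d)) (/1≡mkℚ (suc d))) (QP.normalize-coprime coprime) ⟩
  p * mkℚ (ℤ.+ 1) d coprime     ≡⟨ QP.*-inverseʳ p ⟩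
  1ℚ                            ∎
  where
  coprime : Coprime 1 (suc d)
  coprime = 1-coprimeTo (suc d)
  p : ℚ
  p = mkℚ (ℤ.+ suc d) 0 (Coprime-sym coprime)

ι-∸ : ∀ a b → b ℕ.≤ a → ι (a ∸ b) ≡ ι a - ι b
ι-∸ a b b≤a = begin
  ι (a ∸ b)                  ≡⟨ solve 2 (λ x y → x := (x :+ y) :- y) refl (ι (a ∸ b)) (ι b) ⟩
  (ι (a ∸ b) + ι b) - ι b    ≡⟨ cong (_- ι b) (ι-+ (a ∸ b) b) ⟨
  ι (a ∸ b ℕ.+ b) - ι b      ≡⟨ cong (λ z → ι z - ι b) (NP.m∸n+n≡m b≤a) ⟩
  ι a - ι b                  ∎

ι-∑ : ∀ n f → ι (ℕ∑.∑ n f) ≡ ∑ n (λ i → ι (f i))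
ι-∑ zero    f = refl
ι-∑ (suc n) f = trans (ι-+ (f 0) _) (cong (ι (f 0) +_) (ι-∑ n (λ i → f (suc i))))

ι-if : ∀ b n → ι (if b then n else 0) ≡ (if b then ι n else 0ℚ)
ι-if true  n = refl
ι-if false n = refl

∑-by-parts : ∀ N (P g : ℕ → ℚ) →
  ∑ (suc N) (λ z → (P (suc z) - P z) * ∑ z g) ≡ ∑ N (λ t → (P (suc N) - P (suc t)) * g t)
∑-by-parts zero    P g = solve 2 (λ a b → (a :- b) :* con 0ℚ :+ con 0ℚ := con 0ℚ) refl (P 1) (P 0)
∑-by-parts (suc N) P g = begin
  ∑ (2 ℕ.+ N) h                                        ≡⟨ ∑-last (suc N) h ⟩
  ∑ (suc N) h + d * ∑ (suc N) g                        ≡⟨ cong₂ (λ a b → a + d * b) (∑-by-parts N P g) (∑-last N g) ⟩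
  ∑ N (λ t → w t * g t) + d * (∑ N g + g N)            ≡⟨ solve 4 (λ a d b c → a :+ d :* (b :+ c) := (a :+ d :* b) :+ d :* c)
                                                                refl (∑ N (λ t → w t * g t)) d (∑ N g) (g N) ⟩
  (∑ N (λ t → w t * g t) + d * ∑ N g) + d * g N        ≡⟨ cong (_+ d * g N) merge ⟩
  ∑ N (λ t → w′ t * g t) + w′ N * g N                  ≡⟨ ∑-last N (λ t → w′ t * g t) ⟨
  ∑ (suc N) (λ t → w′ t * g t)                         ∎
  where
  h : ℕ → ℚ
  h z = (P (suc z) - P z) * ∑ z g
  w w′ : ℕ → ℚ
  w  t = P (suc N) - P (suc t)
  w′ t = P (2 ℕ.+ N) - P (suc t)
  d : ℚ
  d = P (2 ℕ.+ N) - P (suc N)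

  merge : ∑ N (λ t → w t * g t) + d * ∑ N g ≡ ∑ N (λ t → w′ t * g t)
  merge = begin
    ∑ N (λ t → w t * g t) + d * ∑ N g          ≡⟨ cong (∑ N (λ t → w t * g t) +_) (∑-*ˡ N d g) ⟨
    ∑ N (λ t → w t * g t) + ∑ N (λ t → d * g t) ≡⟨ ∑-+ N _ _ ⟨
    ∑ N (λ t → w t * g t + d * g t)            ≡⟨ ∑-cong N (λ t _ → solve 4 (λ a b c x → (a :- c) :* x :+ (b :- a) :* x := (b :- c) :* x)
                                                                          refl (P (suc N)) (P (2 ℕ.+ N)) (P (suc t)) (g t)) ⟩
    ∑ N (λ t → w′ t * g t)                     ∎

∑-prefixSums : ∀ N (g : ℕ → ℚ) → ∑ (suc N) (λ y → ∑ y g) ≡ ∑ N (λ t → (ι (suc N) - ι (suc t)) * g t)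
∑-prefixSums N g = trans (∑-cong (suc N) (λ z _ → unit-weight z)) (∑-by-parts N ι g)
  where
  unit-weight : ∀ z → ∑ z g ≡ (ι (suc z) - ι z) * ∑ z g
  unit-weight z = solve 2 (λ a s → s := ((con 1ℚ :+ a) :- a) :* s) refl (ι z) (∑ z g)

∑-weightedPrefixSums : ∀ N (g : ℕ → ℚ) →
  ∑ (suc N) (λ z → (ι z + 1ℚ) * ∑ z g) + ∑ (suc N) (λ z → (ι z + 1ℚ) * ∑ z g)
  ≡ ∑ N (λ t → (ι (suc N) * ι (2 ℕ.+ N) - ι (suc t) * ι (2 ℕ.+ t)) * g t)
∑-weightedPrefixSums N g = begin
  ∑ (suc N) h + ∑ (suc N) h
    ≡⟨ ∑-+ (suc N) h h ⟨
  ∑ (suc N) (λ z → h z + h z)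
    ≡⟨ ∑-cong (suc N) (λ z _ → double-weight z) ⟩
  ∑ (suc N) (λ z → (P (suc z) - P z) * ∑ z g)
    ≡⟨ ∑-by-parts N P g ⟩
  ∑ N (λ t → (P (suc N) - P (suc t)) * g t) ∎
  where
  h : ℕ → ℚ
  h z = (ι z + 1ℚ) * ∑ z g
  P : ℕ → ℚ
  P z = ι z * ι (suc z)
  double-weight : ∀ z → h z + h z ≡ (ι (suc z) * ι (2 ℕ.+ z) - ι z * ι (suc z)) * ∑ z g
  double-weight z =
    solve 2 (λ a s → (a :+ con 1ℚ) :* s :+ (a :+ con 1ℚ) :* s
                     := ((con 1ℚ :+ a) :* (con 1ℚ :+ (con 1ℚ :+ a)) :- a :* (con 1ℚ :+ a)) :* s) refl (ι z) (∑ z g)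

-- Counting permutations by their first entries

count : {A : Set} → (A → Bool) → List A → ℕ
count p []       = 0
count p (x ∷ xs) = if p x then suc (count p xs) else count p xs

module _ {A : Set} where

  length-filter : {P : A → Set} (P? : Decidable P) (xs : List A) →
                  length (filter P? xs) ≡ count (λ x → does (P? x)) xs
  length-filter P? []       = refl
  length-filter P? (x ∷ xs) with does (P? x)
  ... | true  = cong suc (length-filter P? xs)
  ... | false = length-filter P? xs

  count-++ : (p : A → Bool) (xs ys : List A) → count p (xs ++ ys) ≡ count p xs ℕ.+ count p ys
  count-++ p []       ys = refl
  count-++ p (x ∷ xs) ys with p x
  ... | true  = cong suc (count-++ p xs ys)
  ... | false = count-++ p xs ys

  count-map : {B : Set} (p : B → Bool) (f : A → B) (xs : List A) →
              count p (map f xs) ≡ count (λ x → p (f x)) xs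
  count-map p f []       = refl
  count-map p f (x ∷ xs) with p (f x)
  ... | true  = cong suc (count-map p f xs)
  ... | false = count-map p f xs

  count-cong : {p q : A → Bool} → (∀ x → p x ≡ q x) → ∀ xs → count p xs ≡ count q xs
  count-cong p≗q []       = refl
  count-cong {q = q} p≗q (x ∷ xs) rewrite p≗q x with q x
  ... | true  = cong suc (count-cong p≗q xs)
  ... | false = count-cong p≗q xs

  count-false : ∀ (xs : List A) → count (λ _ → false) xs ≡ 0
  count-false []       = refl
  count-false (x ∷ xs) = count-false xs

  count-∧ : ∀ b (q : A → Bool) xs → count (λ x → b ∧ q x) xs ≡ (if b then count q xs else 0)
  count-∧ true  q xs = refl
  count-∧ false q xs = count-false xs

  count-concatMap-applyUpTo : ∀ (p : A → Bool) (g : ℕ → List A) n (h : ℕ → ℕ) →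
    count p (concatMap g (applyUpTo h n)) ≡ ℕ∑.∑ n (λ i → count p (g (h i)))
  count-concatMap-applyUpTo p g zero    h = refl
  count-concatMap-applyUpTo p g (suc n) h =
    trans (count-++ p (g (h 0)) _) (cong (count p (g (h 0)) ℕ.+_) (count-concatMap-applyUpTo p g n (h ∘ suc)))

count-seqs-suc : ∀ n k (p : List ℕ → Bool) →
  count p (seqs n (suc k)) ≡ ℕ∑.∑ n (λ i → count (λ τ → p (suc i ∷ τ)) (seqs n k))
count-seqs-suc n k p =
  trans (count-concatMap-applyUpTo p (λ i → map (suc i ∷_) (seqs n k)) n id)
        (ℕ∑.∑-cong n (λ i _ → count-map p (suc i ∷_) (seqs n k)))

punchIn : ℕ → ℕ → ℕ
punchIn zero    x       = suc x
punchIn (suc v) zero    = zero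
punchIn (suc v) (suc x) = suc (punchIn v x)

withFirst : ℕ → List ℕ → List ℕ
withFirst i τ = suc i ∷ map (punchIn (suc i)) τ

punchIn-< : ∀ {v x} → x ℕ.< v → punchIn v x ≡ x
punchIn-< {suc v} {zero}  _         = refl
punchIn-< {suc v} {suc x} (ℕ.s<s x<v) = cong suc (punchIn-< x<v)

punchIn-≥ : ∀ {v x} → v ℕ.≤ x → punchIn v x ≡ suc x
punchIn-≥ {zero}          _           = refl
punchIn-≥ {suc v} {suc x} (ℕ.s≤s v≤x) = cong suc (punchIn-≥ v≤x)

∑-punchIn : ∀ n w (G : ℕ → ℕ) → w ℕ.≤ n →
  ℕ∑.∑ (suc n) (λ i → if not (w ≡ᵇ i) then G i else 0) ≡ ℕ∑.∑ n (λ i → G (punchIn w i))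
∑-punchIn n       zero    G _           = refl
∑-punchIn (suc n) (suc w) G (ℕ.s≤s w≤n) = cong (G 0 ℕ.+_) (∑-punchIn n w (G ∘ suc) w≤n)

_∉ᵇ_ : ℕ → List ℕ → Bool
x ∉ᵇ ys = does (all? (λ y → ¬? (x NP.≟ y)) ys)

uniqueᵇ : List ℕ → Bool
uniqueᵇ σ = does (unique? σ)

count-avoiding : ∀ n k w (p : List ℕ → Bool) → w ℕ.≤ n →
  count (λ τ → suc w ∉ᵇ τ ∧ p τ) (seqs (suc n) k) ≡ count (λ τ → p (map (punchIn (suc w)) τ)) (seqs n k)
count-avoiding n zero    w p w≤n = refl
count-avoiding n (suc k) w p w≤n = begin
  count (λ τ → suc w ∉ᵇ τ ∧ p τ) (seqs (suc n) (suc k))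
    ≡⟨ count-seqs-suc (suc n) k (λ τ → suc w ∉ᵇ τ ∧ p τ) ⟩
  ℕ∑.∑ (suc n) (λ i → count (λ τ → (not (w ≡ᵇ i) ∧ suc w ∉ᵇ τ) ∧ p (suc i ∷ τ)) (seqs (suc n) k))
    ≡⟨ ℕ∑.∑-cong (suc n) (λ i _ → first-entry i) ⟩
  ℕ∑.∑ (suc n) (λ i → if not (w ≡ᵇ i) then G i else 0)
    ≡⟨ ∑-punchIn n w G w≤n ⟩
  ℕ∑.∑ n (λ i → G (punchIn w i))
    ≡⟨ count-seqs-suc n k (λ τ → p (map (punchIn (suc w)) τ)) ⟨
  count (λ τ → p (map (punchIn (suc w)) τ)) (seqs n (suc k)) ∎
  where
  G : ℕ → ℕ
  G i = count (λ τ → p (suc i ∷ map (punchIn (suc w)) τ)) (seqs n k)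

  first-entry : ∀ i → count (λ τ → (not (w ≡ᵇ i) ∧ suc w ∉ᵇ τ) ∧ p (suc i ∷ τ)) (seqs (suc n) k)
                      ≡ (if not (w ≡ᵇ i) then G i else 0)
  first-entry i = begin
    count (λ τ → (not (w ≡ᵇ i) ∧ suc w ∉ᵇ τ) ∧ p (suc i ∷ τ)) (seqs (suc n) k)
      ≡⟨ count-cong (λ τ → ∧-assoc (not (w ≡ᵇ i)) (suc w ∉ᵇ τ) (p (suc i ∷ τ))) (seqs (suc n) k) ⟩
    count (λ τ → not (w ≡ᵇ i) ∧ (suc w ∉ᵇ τ ∧ p (suc i ∷ τ))) (seqs (suc n) k)
      ≡⟨ count-∧ (not (w ≡ᵇ i)) (λ τ → suc w ∉ᵇ τ ∧ p (suc i ∷ τ)) (seqs (suc n) k) ⟩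
    (if not (w ≡ᵇ i) then count (λ τ → suc w ∉ᵇ τ ∧ p (suc i ∷ τ)) (seqs (suc n) k) else 0)
      ≡⟨ cong (if not (w ≡ᵇ i) then_else 0) (count-avoiding n k w (λ τ → p (suc i ∷ τ)) w≤n) ⟩
    (if not (w ≡ᵇ i) then G i else 0) ∎

punchIn-≡ᵇ : ∀ v a b → (punchIn v a ≡ᵇ punchIn v b) ≡ (a ≡ᵇ b)
punchIn-≡ᵇ zero    a       b       = refl
punchIn-≡ᵇ (suc v) zero    zero    = refl
punchIn-≡ᵇ (suc v) zero    (suc b) = refl
punchIn-≡ᵇ (suc v) (suc a) zero    = refl
punchIn-≡ᵇ (suc v) (suc a) (suc b) = punchIn-≡ᵇ v a b

punchIn-<ᵇ : ∀ v a b → (punchIn v a <ᵇ punchIn v b) ≡ (a <ᵇ b)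
punchIn-<ᵇ zero    a       b       = refl
punchIn-<ᵇ (suc v) zero    zero    = refl
punchIn-<ᵇ (suc v) zero    (suc b) = refl
punchIn-<ᵇ (suc v) (suc a) zero    = refl
punchIn-<ᵇ (suc v) (suc a) (suc b) = punchIn-<ᵇ v a b

punchIn-∉ᵇ : ∀ v a τ → (punchIn v a ∉ᵇ map (punchIn v) τ) ≡ (a ∉ᵇ τ)
punchIn-∉ᵇ v a []      = refl
punchIn-∉ᵇ v a (b ∷ τ) = cong₂ _∧_ (cong not (punchIn-≡ᵇ v a b)) (punchIn-∉ᵇ v a τ)

uniqueᵇ-map-punchIn : ∀ v τ → uniqueᵇ (map (punchIn v) τ) ≡ uniqueᵇ τ
uniqueᵇ-map-punchIn v []      = refl
uniqueᵇ-map-punchIn v (a ∷ τ) = cong₂ _∧_ (punchIn-∉ᵇ v a τ) (uniqueᵇ-map-punchIn v τ)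

#perms : ℕ → (List ℕ → Bool) → ℕ
#perms n p = count (λ σ → uniqueᵇ σ ∧ p σ) (seqs n n)

#perms-suc : ∀ n p → #perms (suc n) p ≡ ℕ∑.∑ (suc n) (λ i → #perms n (λ τ → p (withFirst i τ)))
#perms-suc n p =
  trans (count-seqs-suc (suc n) n (λ σ → uniqueᵇ σ ∧ p σ))
        (ℕ∑.∑-cong (suc n) (λ i i<1+n → begin
          count (λ τ → (suc i ∉ᵇ τ ∧ uniqueᵇ τ) ∧ p (suc i ∷ τ)) (seqs (suc n) n)
            ≡⟨ count-cong (λ τ → ∧-assoc (suc i ∉ᵇ τ) (uniqueᵇ τ) (p (suc i ∷ τ))) (seqs (suc n) n) ⟩
          count (λ τ → suc i ∉ᵇ τ ∧ (uniqueᵇ τ ∧ p (suc i ∷ τ))) (seqs (suc n) n)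
            ≡⟨ count-avoiding n n i (λ τ → uniqueᵇ τ ∧ p (suc i ∷ τ)) (ℕ.s≤s⁻¹ i<1+n) ⟩
          count (λ τ → uniqueᵇ (map (punchIn (suc i)) τ) ∧ p (withFirst i τ)) (seqs n n)
            ≡⟨ count-cong (λ τ → cong (_∧ p (withFirst i τ)) (uniqueᵇ-map-punchIn (suc i) τ)) (seqs n n) ⟩
          #perms n (λ τ → p (withFirst i τ)) ∎))

#perms-∧ : ∀ n b (p : List ℕ → Bool) → #perms n (λ τ → b ∧ p τ) ≡ (if b then #perms n p else 0)
#perms-∧ n b p = trans (count-cong (λ τ → x∙yz≈y∙xz (uniqueᵇ τ) b (p τ)) (seqs n n))
                       (count-∧ b (λ σ → uniqueᵇ σ ∧ p σ) (seqs n n))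

upᵇ downᵇ condᵇ : List ℕ → Bool
upᵇ   σ = does (up? σ)
downᵇ σ = does (down? σ)
condᵇ σ = does (cond? σ)

mutual
  upᵇ-map-punchIn : ∀ v τ → upᵇ (map (punchIn v) τ) ≡ upᵇ τ
  upᵇ-map-punchIn v []          = refl
  upᵇ-map-punchIn v (x ∷ [])    = refl
  upᵇ-map-punchIn v (x ∷ y ∷ τ) = cong₂ _∧_ (punchIn-<ᵇ v x y) (downᵇ-map-punchIn v (y ∷ τ))

  downᵇ-map-punchIn : ∀ v τ → downᵇ (map (punchIn v) τ) ≡ downᵇ τ
  downᵇ-map-punchIn v []          = refl
  downᵇ-map-punchIn v (x ∷ [])    = refl
  downᵇ-map-punchIn v (x ∷ y ∷ τ) = cong₂ _∧_ (punchIn-<ᵇ v y x) (upᵇ-map-punchIn v (y ∷ τ))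

-- A removed first entry i + 1 compares with the standardised rest as i + ½ would, hence as i in upᵇ (i ∷ τ).
suc-<ᵇ-punchIn : ∀ i r → (suc i <ᵇ punchIn (suc i) r) ≡ (i <ᵇ r)
suc-<ᵇ-punchIn i zero    = refl
suc-<ᵇ-punchIn i (suc r) = lemma i r
  where
  lemma : ∀ i r → (i <ᵇ punchIn i r) ≡ (i <ᵇ suc r)
  lemma zero    r       = refl
  lemma (suc i) zero    = refl
  lemma (suc i) (suc r) = lemma i r

punchIn-<ᵇ-self : ∀ j r → (punchIn j r <ᵇ j) ≡ (r <ᵇ j)
punchIn-<ᵇ-self zero    r       = refl
punchIn-<ᵇ-self (suc j) zero    = refl
punchIn-<ᵇ-self (suc j) (suc r) = punchIn-<ᵇ-self j r

upᵇ-withFirst : ∀ i τ → upᵇ (withFirst i τ) ≡ upᵇ (i ∷ τ)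
upᵇ-withFirst i []      = refl
upᵇ-withFirst i (r ∷ τ) = cong₂ _∧_ (suc-<ᵇ-punchIn i r) (downᵇ-map-punchIn (suc i) (r ∷ τ))

downᵇ-withFirst : ∀ i τ → downᵇ (withFirst i τ) ≡ downᵇ (suc i ∷ τ)
downᵇ-withFirst i []      = refl
downᵇ-withFirst i (r ∷ τ) = cong₂ _∧_ (punchIn-<ᵇ-self (suc i) r) (upᵇ-map-punchIn (suc i) (r ∷ τ))

#up #down : ℕ → ℕ → ℕ
#up   m x = #perms m (λ ρ → upᵇ (x ∷ ρ))
#down m x = #perms m (λ ρ → downᵇ (x ∷ ρ))

#up-suc : ∀ q x → #up (suc q) x ≡ ℕ∑.∑ (suc q) (λ i → if x <ᵇ suc i then #down q (suc i) else 0)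
#up-suc q x = trans (#perms-suc q (λ ρ → upᵇ (x ∷ ρ))) (ℕ∑.∑-cong (suc q) (λ i _ →
  trans (count-cong (λ τ → cong (λ b → uniqueᵇ τ ∧ ((x <ᵇ suc i) ∧ b)) (downᵇ-withFirst i τ)) (seqs q q))
        (#perms-∧ q (x <ᵇ suc i) (λ τ → downᵇ (suc i ∷ τ)))))

#down-suc : ∀ q x → #down (suc q) x ≡ ℕ∑.∑ (suc q) (λ i → if suc i <ᵇ x then #up q i else 0)
#down-suc q x = trans (#perms-suc q (λ ρ → downᵇ (x ∷ ρ))) (ℕ∑.∑-cong (suc q) (λ i _ →
  trans (count-cong (λ τ → cong (λ b → uniqueᵇ τ ∧ ((suc i <ᵇ x) ∧ b)) (upᵇ-withFirst i τ)) (seqs q q))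
        (#perms-∧ q (suc i <ᵇ x) (λ τ → upᵇ (i ∷ τ)))))

<ᵇ-true : ∀ {a b} → a ℕ.< b → (a <ᵇ b) ≡ true
<ᵇ-true {zero}  {suc b} _           = refl
<ᵇ-true {suc a} {suc b} (ℕ.s<s a<b) = <ᵇ-true a<b

<ᵇ-false : ∀ {a b} → b ℕ.≤ a → (a <ᵇ b) ≡ false
<ᵇ-false {a}     {zero}  _           = refl
<ᵇ-false {suc a} {suc b} (ℕ.s≤s b≤a) = <ᵇ-false b≤a

condᵇ-withFirst³ : ∀ i j l →
  ((i <ᵇ suc j) ∧ (l <ᵇ j)) ∧ condᵇ (withFirst i (withFirst j (withFirst l [])))
  ≡ (i <ᵇ suc l) ∧ (suc l <ᵇ j)
condᵇ-withFirst³ i j l with i ≤? j | l <? j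
... | no i≰j | _ rewrite <ᵇ-false (NP.≰⇒> i≰j) with i ≤? l
...   | yes i≤l = sym (trans (cong ((i <ᵇ suc l) ∧_) (<ᵇ-false j≤1+l)) (∧-zeroʳ _))
  where
  j≤1+l : j ℕ.≤ suc l
  j≤1+l = NP.≤-trans (NP.<⇒≤ (NP.≰⇒> i≰j)) (NP.m≤n⇒m≤1+n i≤l)
...   | no  i≰l rewrite <ᵇ-false (NP.≰⇒> i≰l) = refl
condᵇ-withFirst³ i j l | yes i≤j | no l≮j
  rewrite <ᵇ-true (ℕ.s≤s i≤j) | <ᵇ-false (NP.≮⇒≥ l≮j) =
  sym (trans (cong ((i <ᵇ suc l) ∧_) (<ᵇ-false (NP.m≤n⇒m≤1+n (NP.≮⇒≥ l≮j)))) (∧-zeroʳ _))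
condᵇ-withFirst³ i j l | yes i≤j | yes l<j
  rewrite <ᵇ-true (ℕ.s≤s i≤j) | <ᵇ-true l<j | punchIn-< {j} {l} l<j | punchIn-≥ {i} {j} i≤j
  with i ≤? l
... | yes i≤l rewrite punchIn-≥ {i} {l} i≤l | NP.+-comm l 1 | NP.+-comm i 1 | <ᵇ-true (ℕ.s≤s i≤l) =
  ∧-identityʳ _
... | no  i≰l rewrite punchIn-< {i} {l} (NP.≰⇒> i≰l) | NP.+-comm l 1 | NP.+-comm i 1
                    | <ᵇ-false (NP.<⇒≤ (NP.≰⇒> i≰l)) | <ᵇ-false (NP.≰⇒> i≰l) =
  ∧-zeroʳ _

upᵇ∧condᵇ-withFirst³³ : ∀ i j l ρ →
  let σ = withFirst i (withFirst j (withFirst l ρ)) in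
  upᵇ σ ∧ condᵇ σ ≡ ((i <ᵇ suc l) ∧ (suc l <ᵇ j)) ∧ upᵇ (l ∷ ρ)
upᵇ∧condᵇ-withFirst³³ i j l ρ = begin
  upᵇ σ ∧ c                                           ≡⟨ cong (_∧ c) upᵇσ ⟩
  ((i <ᵇ suc j) ∧ ((l <ᵇ j) ∧ upᵇ (l ∷ ρ))) ∧ c       ≡⟨ cong (_∧ c) (∧-assoc (i <ᵇ suc j) (l <ᵇ j) (upᵇ (l ∷ ρ))) ⟨
  (((i <ᵇ suc j) ∧ (l <ᵇ j)) ∧ upᵇ (l ∷ ρ)) ∧ c       ≡⟨ xy∙z≈xz∙y ((i <ᵇ suc j) ∧ (l <ᵇ j)) (upᵇ (l ∷ ρ)) c ⟩
  (((i <ᵇ suc j) ∧ (l <ᵇ j)) ∧ c) ∧ upᵇ (l ∷ ρ)       ≡⟨ cong (_∧ upᵇ (l ∷ ρ)) (condᵇ-withFirst³ i j l) ⟩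
  ((i <ᵇ suc l) ∧ (suc l <ᵇ j)) ∧ upᵇ (l ∷ ρ)         ∎
  where
  σ : List ℕ
  σ = withFirst i (withFirst j (withFirst l ρ))
  c : Bool
  c = condᵇ σ
  upᵇσ : upᵇ σ ≡ (i <ᵇ suc j) ∧ ((l <ᵇ j) ∧ upᵇ (l ∷ ρ))
  upᵇσ = trans (upᵇ-withFirst i (withFirst j (withFirst l ρ)))
          (cong ((i <ᵇ suc j) ∧_) (trans (downᵇ-withFirst j (withFirst l ρ))
                                        (cong ((l <ᵇ j) ∧_) (upᵇ-withFirst l ρ))))

countA-by-first-three : ∀ m → countA (3 ℕ.+ m) ≡
  ℕ∑.∑ (3 ℕ.+ m) (λ i → ℕ∑.∑ (2 ℕ.+ m) (λ j → ℕ∑.∑ (1 ℕ.+ m) (λ l →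
    if (i <ᵇ suc l) ∧ (suc l <ᵇ j) then #up m l else 0)))
countA-by-first-three m =
  trans (length-filter (λ σ → unique? σ ×-dec (alternating? σ ×-dec cond? σ)) (seqs (3 ℕ.+ m) (3 ℕ.+ m)))
  (trans (#perms-suc (2 ℕ.+ m) P) (ℕ∑.∑-cong (3 ℕ.+ m) (λ i _ →
  trans (#perms-suc (1 ℕ.+ m) (P₁ i)) (ℕ∑.∑-cong (2 ℕ.+ m) (λ j _ →
  trans (#perms-suc m (P₂ i j)) (ℕ∑.∑-cong (1 ℕ.+ m) (λ l _ →
  trans (count-cong (λ ρ → cong (uniqueᵇ ρ ∧_) (upᵇ∧condᵇ-withFirst³³ i j l ρ)) (seqs m m))
        (#perms-∧ m ((i <ᵇ suc l) ∧ (suc l <ᵇ j)) (λ ρ → upᵇ (l ∷ ρ))))))))))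
  where
  P : List ℕ → Bool
  P σ = upᵇ σ ∧ condᵇ σ

  P₁ : ℕ → List ℕ → Bool
  P₁ i τ = P (withFirst i τ)

  P₂ : ℕ → ℕ → List ℕ → Bool
  P₂ i j μ = P₁ i (withFirst j μ)

∑ℕ-const : ∀ n x → ℕ∑.∑ n (λ _ → x) ≡ n ℕ.* x
∑ℕ-const zero    x = refl
∑ℕ-const (suc n) x = cong (x ℕ.+_) (∑ℕ-const n x)

countA-formula : ∀ m → countA (3 ℕ.+ m) ≡ ℕ∑.∑ (suc m) (λ l → suc l ℕ.* ((m ∸ l) ℕ.* #up m l))
countA-formula m = begin
  countA (3 ℕ.+ m)
    ≡⟨ countA-by-first-three m ⟩
  ℕ∑.∑ (3 ℕ.+ m) (λ i → ℕ∑.∑ (2 ℕ.+ m) (λ j → ℕ∑.∑ (1 ℕ.+ m) (λ l → term i j l)))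
    ≡⟨ ℕ∑.∑-cong (3 ℕ.+ m) (λ i _ → ℕ∑.∑-swap (2 ℕ.+ m) (1 ℕ.+ m) (term i)) ⟩
  ℕ∑.∑ (3 ℕ.+ m) (λ i → ℕ∑.∑ (1 ℕ.+ m) (λ l → ℕ∑.∑ (2 ℕ.+ m) (λ j → term i j l)))
    ≡⟨ ℕ∑.∑-swap (3 ℕ.+ m) (1 ℕ.+ m) (λ i l → ℕ∑.∑ (2 ℕ.+ m) (λ j → term i j l)) ⟩
  ℕ∑.∑ (1 ℕ.+ m) (λ l → ℕ∑.∑ (3 ℕ.+ m) (λ i → ℕ∑.∑ (2 ℕ.+ m) (λ j → term i j l)))
    ≡⟨ ℕ∑.∑-cong (1 ℕ.+ m) (λ l l≤m → fixed-l (ℕ.s≤s⁻¹ l≤m)) ⟩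
  ℕ∑.∑ (suc m) (λ l → suc l ℕ.* ((m ∸ l) ℕ.* #up m l)) ∎
  where
  term : ℕ → ℕ → ℕ → ℕ
  term i j l = if (i <ᵇ suc l) ∧ (suc l <ᵇ j) then #up m l else 0

  fixed-l : ∀ {l} → l ℕ.≤ m →
    ℕ∑.∑ (3 ℕ.+ m) (λ i → ℕ∑.∑ (2 ℕ.+ m) (λ j → term i j l)) ≡ suc l ℕ.* ((m ∸ l) ℕ.* #up m l)
  fixed-l {l} l≤m = begin
    ℕ∑.∑ (3 ℕ.+ m) (λ i → ℕ∑.∑ (2 ℕ.+ m) (λ j → term i j l))
      ≡⟨ ℕ∑.∑-cong (3 ℕ.+ m) (λ i _ → trans (ℕ∑.∑-cong (2 ℕ.+ m) (λ j _ → if-∧ (i <ᵇ suc l) (suc l <ᵇ j)))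
                                            (ℕ∑.∑-if (2 ℕ.+ m) (i <ᵇ suc l) (λ j → if suc l <ᵇ j then U else 0))) ⟩
    ℕ∑.∑ (3 ℕ.+ m) (λ i → if i <ᵇ suc l then larger else 0)
      ≡⟨ ℕ∑.∑-prefix (3 ℕ.+ m) (suc l) (λ _ → larger) (NP.m≤n⇒m≤1+n (NP.m≤n⇒m≤1+n (ℕ.s≤s l≤m))) ⟩
    ℕ∑.∑ (suc l) (λ _ → larger)
      ≡⟨ ∑ℕ-const (suc l) larger ⟩
    suc l ℕ.* larger
      ≡⟨ cong (suc l ℕ.*_) (trans (ℕ∑.∑-suffix (2 ℕ.+ m) (2 ℕ.+ l) (λ _ → U) (ℕ.s≤s (ℕ.s≤s l≤m)))
                                  (∑ℕ-const (m ∸ l) U)) ⟩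
    suc l ℕ.* ((m ∸ l) ℕ.* U) ∎
    where
    U larger : ℕ
    U = #up m l
    larger = ℕ∑.∑ (2 ℕ.+ m) (λ j → if suc l <ᵇ j then U else 0)

    if-∧ : ∀ a b → (if a ∧ b then U else 0) ≡ (if a then (if b then U else 0) else 0)
    if-∧ true  b = refl
    if-∧ false b = refl

-- Entringer numbers

record IsEntringer (e : ℕ → ℕ → ℚ) : Set where
  field
    zero-zero : e 0 0 ≡ 1ℚ
    suc-zero  : ∀ n → e (suc n) 0 ≡ 0ℚ
    suc-suc   : ∀ n k → k ℕ.≤ n → e (suc n) (suc k) ≡ e (suc n) k + e n (n ∸ k)

module Entringer {e : ℕ → ℕ → ℚ} (isEntringer : IsEntringer e) where

  open IsEntringer isEntringer

  e-suc≡∑ : ∀ q K → K ℕ.≤ suc q → e (suc q) K ≡ ∑ K (λ t → e q (q ∸ t))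
  e-suc≡∑ q zero    _           = suc-zero q
  e-suc≡∑ q (suc K) (ℕ.s≤s K≤q) = begin
    e (suc q) (suc K)                         ≡⟨ suc-suc q K K≤q ⟩
    e (suc q) K + e q (q ∸ K)                 ≡⟨ cong (_+ e q (q ∸ K)) (e-suc≡∑ q K (NP.m≤n⇒m≤1+n K≤q)) ⟩
    ∑ K (λ t → e q (q ∸ t)) + e q (q ∸ K)     ≡⟨ ∑-last K (λ t → e q (q ∸ t)) ⟨
    ∑ (suc K) (λ t → e q (q ∸ t))             ∎

  mutual
    #up≡entringer : ∀ q x → x ℕ.≤ q → ι (#up q x) ≡ e q (q ∸ x)
    #up≡entringer zero    zero _     = trans (QP.+-identityʳ 1ℚ) (sym zero-zero)
    #up≡entringer (suc q) x x≤1+q = begin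
      ι (#up (suc q) x)
        ≡⟨ cong ι (#up-suc q x) ⟩
      ι (ℕ∑.∑ (suc q) (λ i → if x <ᵇ suc i then #down q (suc i) else 0))
        ≡⟨ ι-∑ (suc q) (λ i → if x <ᵇ suc i then #down q (suc i) else 0) ⟩
      ∑ (suc q) (λ i → ι (if x <ᵇ suc i then #down q (suc i) else 0))
        ≡⟨ ∑-cong (suc q) (λ i i<1+q → trans (ι-if (x <ᵇ suc i) (#down q (suc i)))
                                             (cong (if x <ᵇ suc i then_else 0ℚ) (#down≡entringer q i (ℕ.s≤s⁻¹ i<1+q)))) ⟩
      ∑ (suc q) (λ i → if x <ᵇ suc i then e q i else 0ℚ)
        ≡⟨ ∑-suffix (suc q) x (e q) x≤1+q ⟩
      ∑ K (λ t → e q (x ℕ.+ t))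
        ≡⟨ ∑-reverse K (λ t → e q (x ℕ.+ t)) ⟨
      ∑ K (λ t → e q (x ℕ.+ (K ∸ suc t)))
        ≡⟨ ∑-cong K (λ t t<K → cong (e q) (reflect t<K)) ⟩
      ∑ K (λ t → e q (q ∸ t))
        ≡⟨ e-suc≡∑ q K (NP.m∸n≤m (suc q) x) ⟨
      e (suc q) K ∎
      where
      K : ℕ
      K = suc q ∸ x
      reflect : ∀ {t} → t ℕ.< K → x ℕ.+ (K ∸ suc t) ≡ q ∸ t
      reflect {t} t<K = trans (sym (NP.+-∸-assoc x t<K)) (cong (_∸ suc t) (NP.m+[n∸m]≡n x≤1+q))

    #down≡entringer : ∀ q y → y ℕ.≤ q → ι (#down q (suc y)) ≡ e q y
    #down≡entringer zero    zero _     = trans (QP.+-identityʳ 1ℚ) (sym zero-zero)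
    #down≡entringer (suc q) y y≤1+q = begin
      ι (#down (suc q) (suc y))
        ≡⟨ cong ι (#down-suc q (suc y)) ⟩
      ι (ℕ∑.∑ (suc q) (λ i → if i <ᵇ y then #up q i else 0))
        ≡⟨ ι-∑ (suc q) (λ i → if i <ᵇ y then #up q i else 0) ⟩
      ∑ (suc q) (λ i → ι (if i <ᵇ y then #up q i else 0))
        ≡⟨ ∑-cong (suc q) (λ i i<1+q → trans (ι-if (i <ᵇ y) (#up q i))
                                             (cong (if i <ᵇ y then_else 0ℚ) (#up≡entringer q i (ℕ.s≤s⁻¹ i<1+q)))) ⟩
      ∑ (suc q) (λ i → if i <ᵇ y then e q (q ∸ i) else 0ℚ)
        ≡⟨ ∑-prefix (suc q) y (λ i → e q (q ∸ i)) y≤1+q ⟩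
      ∑ y (λ i → e q (q ∸ i))
        ≡⟨ e-suc≡∑ q y y≤1+q ⟨
      e (suc q) y ∎

  diagonal-suc-suc : ∀ n → e (2 ℕ.+ n) (2 ℕ.+ n) ≡ ∑ (2 ℕ.+ n) (λ y → ∑ y (λ t → e n (n ∸ t)))
  diagonal-suc-suc n = begin
    e (2 ℕ.+ n) (2 ℕ.+ n)                           ≡⟨ e-suc≡∑ (suc n) (2 ℕ.+ n) NP.≤-refl ⟩
    ∑ (2 ℕ.+ n) (λ t → e (suc n) (suc n ∸ t))       ≡⟨ ∑-reverse (2 ℕ.+ n) (e (suc n)) ⟩
    ∑ (2 ℕ.+ n) (e (suc n))                         ≡⟨ ∑-cong (2 ℕ.+ n) (λ y y<2+n → e-suc≡∑ n y (ℕ.s≤s⁻¹ y<2+n)) ⟩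
    ∑ (2 ℕ.+ n) (λ y → ∑ y (λ t → e n (n ∸ t)))     ∎

  module Diagonal (m : ℕ) where

    A : ℕ → ℚ
    A t = e m (m ∸ t)

    c : ℚ
    c = ι (2 ℕ.+ m)

    w₂ w₃ : ℕ → ℚ
    w₂ t = ι (2 ℕ.+ m) - ι (suc t)
    w₃ t = ι (2 ℕ.+ m) * ι (3 ℕ.+ m) - ι (suc t) * ι (2 ℕ.+ t)

    diagonal₁ : e (suc m) (suc m) ≡ ∑ (suc m) A
    diagonal₁ = e-suc≡∑ m (suc m) NP.≤-refl

    diagonal₂ : e (2 ℕ.+ m) (2 ℕ.+ m) ≡ ∑ (suc m) (λ t → w₂ t * A t)
    diagonal₂ = trans (diagonal-suc-suc m) (∑-prefixSums (suc m) A)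

    diagonal₃ : e (3 ℕ.+ m) (3 ℕ.+ m) + e (3 ℕ.+ m) (3 ℕ.+ m) ≡ ∑ (suc m) (λ t → w₃ t * A t)
    diagonal₃ = trans (cong₂ _+_ single single) (∑-weightedPrefixSums (suc m) A)
      where
      f : ℕ → ℚ
      f z = (ι z + 1ℚ) * ∑ z A

      reflected : ∀ t → t ℕ.≤ suc m → (ι (3 ℕ.+ m) - ι (suc t)) * e (suc m) (suc m ∸ t) ≡ f (suc m ∸ t)
      reflected t t≤1+m = cong₂ _*_ weight (e-suc≡∑ m (suc m ∸ t) (NP.m∸n≤m (suc m) t))
        where
        weight : ι (3 ℕ.+ m) - ι (suc t) ≡ ι (suc m ∸ t) + 1ℚ
        weight = begin
          ι (3 ℕ.+ m) - ι (suc t)        ≡⟨ solve 2 (λ a b → (con 1ℚ :+ (con 1ℚ :+ (con 1ℚ :+ a))) :- (con 1ℚ :+ b)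
                                                             := ((con 1ℚ :+ a) :- b) :+ con 1ℚ) refl (ι m) (ι t) ⟩
          (ι (suc m) - ι t) + 1ℚ         ≡⟨ cong (_+ 1ℚ) (ι-∸ (suc m) t t≤1+m) ⟨
          ι (suc m ∸ t) + 1ℚ             ∎

      single : e (3 ℕ.+ m) (3 ℕ.+ m) ≡ ∑ (2 ℕ.+ m) f
      single = begin
        e (3 ℕ.+ m) (3 ℕ.+ m)
          ≡⟨ diagonal-suc-suc (suc m) ⟩
        ∑ (3 ℕ.+ m) (λ y → ∑ y (λ t → e (suc m) (suc m ∸ t)))
          ≡⟨ ∑-prefixSums (2 ℕ.+ m) (λ t → e (suc m) (suc m ∸ t)) ⟩
        ∑ (2 ℕ.+ m) (λ t → (ι (3 ℕ.+ m) - ι (suc t)) * e (suc m) (suc m ∸ t))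
          ≡⟨ ∑-cong (2 ℕ.+ m) (λ t t<2+m → reflected t (ℕ.s≤s⁻¹ t<2+m)) ⟩
        ∑ (2 ℕ.+ m) (λ t → f (suc m ∸ t))
          ≡⟨ ∑-reverse (2 ℕ.+ m) f ⟩
        ∑ (2 ℕ.+ m) f ∎

    -- (l+1)(m−l) = ((m+2)(m+3) − (l+1)(l+2)) − (m+2)(m+1−l) − (m+2).
    countA-term : ∀ {l} → l ℕ.≤ m →
      ι (suc l ℕ.* ((m ∸ l) ℕ.* #up m l)) ≡ w₃ l * A l - c * (w₂ l * A l) - c * A l
    countA-term {l} l≤m = begin
      ι (suc l ℕ.* ((m ∸ l) ℕ.* #up m l))
        ≡⟨ trans (ι-* (suc l) ((m ∸ l) ℕ.* #up m l)) (cong (ι (suc l) *_) (ι-* (m ∸ l) (#up m l))) ⟩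
      ι (suc l) * (ι (m ∸ l) * ι (#up m l))
        ≡⟨ cong₂ (λ d u → ι (suc l) * (d * u)) (ι-∸ m l l≤m) (#up≡entringer m l l≤m) ⟩
      ι (suc l) * ((ι m - ι l) * A l)
        ≡⟨ solve 3 (λ a b x →
                      (con 1ℚ :+ b) :* ((a :- b) :* x)
                   := ((con 1ℚ :+ (con 1ℚ :+ a)) :* (con 1ℚ :+ (con 1ℚ :+ (con 1ℚ :+ a)))
                        :- (con 1ℚ :+ b) :* (con 1ℚ :+ (con 1ℚ :+ b))) :* x
                      :- (con 1ℚ :+ (con 1ℚ :+ a)) :* (((con 1ℚ :+ (con 1ℚ :+ a)) :- (con 1ℚ :+ b)) :* x)
                      :- (con 1ℚ :+ (con 1ℚ :+ a)) :* x)
                   refl (ι m) (ι l) (A l) ⟩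
      w₃ l * A l - c * (w₂ l * A l) - c * A l ∎

    countA-entringer : ι (countA (3 ℕ.+ m))
      ≡ (e (3 ℕ.+ m) (3 ℕ.+ m) + e (3 ℕ.+ m) (3 ℕ.+ m)) - c * e (2 ℕ.+ m) (2 ℕ.+ m) - c * e (suc m) (suc m)
    countA-entringer = begin
      ι (countA (3 ℕ.+ m))
        ≡⟨ trans (cong ι (countA-formula m)) (ι-∑ (suc m) (λ l → suc l ℕ.* ((m ∸ l) ℕ.* #up m l))) ⟩
      ∑ (suc m) (λ l → ι (suc l ℕ.* ((m ∸ l) ℕ.* #up m l)))
        ≡⟨ ∑-cong (suc m) (λ l l<1+m → countA-term (ℕ.s≤s⁻¹ l<1+m)) ⟩
      ∑ (suc m) (λ l → T₃ l - T₂ l - T₁ l)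
        ≡⟨ trans (∑-- (suc m) (λ l → T₃ l - T₂ l) T₁) (cong (_- ∑ (suc m) T₁) (∑-- (suc m) T₃ T₂)) ⟩
      ∑ (suc m) T₃ - ∑ (suc m) T₂ - ∑ (suc m) T₁
        ≡⟨ cong₂ (λ a b → ∑ (suc m) T₃ - a - b) (∑-*ˡ (suc m) c (λ l → w₂ l * A l)) (∑-*ˡ (suc m) c A) ⟩
      ∑ (suc m) T₃ - c * ∑ (suc m) (λ l → w₂ l * A l) - c * ∑ (suc m) A
        ≡⟨ cong₂ (λ a b → a - c * b - c * ∑ (suc m) A) (sym diagonal₃) (sym diagonal₂) ⟩
      (e₃ + e₃) - c * e (2 ℕ.+ m) (2 ℕ.+ m) - c * ∑ (suc m) A
        ≡⟨ cong (λ a → (e₃ + e₃) - c * e (2 ℕ.+ m) (2 ℕ.+ m) - c * a) (sym diagonal₁) ⟩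
      (e₃ + e₃) - c * e (2 ℕ.+ m) (2 ℕ.+ m) - c * e (suc m) (suc m) ∎
      where
      e₃ : ℚ
      e₃ = e (3 ℕ.+ m) (3 ℕ.+ m)
      T₁ T₂ T₃ : ℕ → ℚ
      T₁ l = c * A l
      T₂ l = c * (w₂ l * A l)
      T₃ l = w₃ l * A l

-- Exponential generating functions of cos, sin, sec and tan

sumVec-tabulate : ∀ n (h : ℕ → ℚ) → sumVec (V.tabulate {n = n} (λ k → h (toℕ k))) ≡ ∑ n h
sumVec-tabulate zero    h = refl
sumVec-tabulate (suc n) h = cong (h 0 +_) (sumVec-tabulate n (λ i → h (suc i)))

sumVec-zipWith-* : ∀ n (g h : ℕ → ℚ) (v : Vec ℚ n) → (∀ j → V.lookup v j ≡ h (toℕ j)) →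
  sumVec (V.zipWith _*_ (V.tabulate (λ j → g (toℕ j))) v) ≡ ∑ n (λ j → g j * h j)
sumVec-zipWith-* zero    g h []      v≗h = refl
sumVec-zipWith-* (suc n) g h (x ∷ v) v≗h =
  cong₂ _+_ (cong (g 0 *_) (v≗h Fin.zero)) (sumVec-zipWith-* n (g ∘ suc) (h ∘ suc) v (v≗h ∘ Fin.suc))

⊗-∑ : ∀ (f g : PS) n → (f ⊗ g) n ≡ ∑ (suc n) (λ k → f k * g (n ∸ k))
⊗-∑ f g n = sumVec-tabulate (suc n) (λ k → f k * g (n ∸ k))

inv₁-suc : ∀ f n → inv₁ f (suc n) ≡ - ∑ (suc n) (λ j → f (suc j) * inv₁ f (n ∸ j))
inv₁-suc f n = cong -_ (sumVec-zipWith-* (suc n) (f ∘ suc) (λ j → inv₁ f (n ∸ j)) (invRev f n) (lookup-invRev n))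
  where
  lookup-invRev : ∀ n (j : Fin (suc n)) → V.lookup (invRev f n) j ≡ inv₁ f (n ∸ toℕ j)
  lookup-invRev zero    Fin.zero    = refl
  lookup-invRev (suc n) Fin.zero    = refl
  lookup-invRev (suc n) (Fin.suc j) = lookup-invRev n j

⊗-inv₁ : ∀ f → f 0 ≡ 1ℚ → ∀ n → (f ⊗ inv₁ f) (suc n) ≡ 0ℚ
⊗-inv₁ f f0≡1 n = begin
  (f ⊗ inv₁ f) (suc n)                   ≡⟨ ⊗-∑ f (inv₁ f) (suc n) ⟩
  f 0 * inv₁ f (suc n) + S               ≡⟨ cong (λ a → a * inv₁ f (suc n) + S) f0≡1 ⟩
  1ℚ * inv₁ f (suc n) + S                ≡⟨ cong (λ a → 1ℚ * a + S) (inv₁-suc f n) ⟩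
  1ℚ * (- S) + S                         ≡⟨ solve 1 (λ s → con 1ℚ :* (:- s) :+ s := con 0ℚ) refl S ⟩
  0ℚ                                     ∎
  where
  S : ℚ
  S = ∑ (suc n) (λ j → f (suc j) * inv₁ f (n ∸ j))

egf : PS → ℕ → ℚ
egf f n = ι (n !) * f n

nCk*k!*[n∸k]!≡n! : ∀ {n k} → k ℕ.≤ n → (n C k) ℕ.* (k ! ℕ.* (n ∸ k) !) ≡ n !
nCk*k!*[n∸k]!≡n! {n} {k} k≤n =
  trans (cong (ℕ._* (k ! ℕ.* (n ∸ k) !)) (nCk≡n!/k![n-k]! k≤n)) (m/n*n≡m {{k !* (n ∸ k) !≢0}} (k![n∸k]!∣n! k≤n))

egf-⊗ : ∀ (f g : PS) n → egf (f ⊗ g) n ≡ ∑ (suc n) (λ k → ι (n C k) * egf f k * egf g (n ∸ k))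
egf-⊗ f g n = begin
  ι (n !) * (f ⊗ g) n                                          ≡⟨ cong (ι (n !) *_) (⊗-∑ f g n) ⟩
  ι (n !) * ∑ (suc n) (λ k → f k * g (n ∸ k))                  ≡⟨ ∑-*ˡ (suc n) (ι (n !)) (λ k → f k * g (n ∸ k)) ⟨
  ∑ (suc n) (λ k → ι (n !) * (f k * g (n ∸ k)))                ≡⟨ ∑-cong (suc n) (λ k k<1+n → term (ℕ.s≤s⁻¹ k<1+n)) ⟩
  ∑ (suc n) (λ k → ι (n C k) * egf f k * egf g (n ∸ k))        ∎
  where
  term : ∀ {k} → k ℕ.≤ n → ι (n !) * (f k * g (n ∸ k)) ≡ ι (n C k) * egf f k * egf g (n ∸ k)
  term {k} k≤n = begin
    ι (n !) * (f k * g (n ∸ k))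
      ≡⟨ cong (λ a → ι a * (f k * g (n ∸ k))) (nCk*k!*[n∸k]!≡n! k≤n) ⟨
    ι ((n C k) ℕ.* (k ! ℕ.* (n ∸ k) !)) * (f k * g (n ∸ k))
      ≡⟨ cong (_* (f k * g (n ∸ k))) (trans (ι-* (n C k) _) (cong (ι (n C k) *_) (ι-* (k !) ((n ∸ k) !)))) ⟩
    ι (n C k) * (ι (k !) * ι ((n ∸ k) !)) * (f k * g (n ∸ k))
      ≡⟨ solve 5 (λ c a b x y → c :* (a :* b) :* (x :* y) := c :* (a :* x) :* (b :* y))
               refl (ι (n C k)) (ι (k !)) (ι ((n ∸ k) !)) (f k) (g (n ∸ k)) ⟩
    ι (n C k) * egf f k * egf g (n ∸ k) ∎

cosNum sinNum : ℕ → ℚ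
cosNum zero          = 1ℚ
cosNum (suc zero)    = 0ℚ
cosNum (suc (suc n)) = - cosNum n
sinNum zero          = 0ℚ
sinNum (suc zero)    = 1ℚ
sinNum (suc (suc n)) = - sinNum n

sinNum-suc : ∀ n → sinNum (suc n) ≡ cosNum n
sinNum-suc zero          = refl
sinNum-suc (suc zero)    = refl
sinNum-suc (suc (suc n)) = cong -_ (sinNum-suc n)

cosNum-suc : ∀ n → cosNum (suc n) ≡ - sinNum n
cosNum-suc zero          = refl
cosNum-suc (suc zero)    = refl
cosNum-suc (suc (suc n)) = cong -_ (cosNum-suc n)

-- cosPS and sinPS are computed by helpers local to Defs, which cannot be named. The with-clauses
-- below let unification solve cosHelper and sinHelper for them, after which cosPS n reduces to
-- cosHelper n n.
mutual
  cosHelper sinHelper : ℕ → ℕ → ℚ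
  cosHelper = _
  sinHelper = _

  cosPS-suc-suc : ∀ m → cosPS (suc (suc m)) ≡ - cosHelper m (suc (suc m))
  cosPS-suc-suc m with suc (suc m)
  ... | _ = refl

  sinPS-suc-suc : ∀ m → sinPS (suc (suc m)) ≡ - sinHelper m (suc (suc m))
  sinPS-suc-suc m with suc (suc m)
  ... | _ = refl

cosHelper≡ : ∀ m k → cosHelper m k ≡ cosNum m * invFact k
cosHelper≡ zero          k = sym (QP.*-identityˡ (invFact k))
cosHelper≡ (suc zero)    k = sym (QP.*-zeroˡ (invFact k))
cosHelper≡ (suc (suc m)) k = trans (cong -_ (cosHelper≡ m k)) (QP.neg-distribˡ-* (cosNum m) (invFact k))

sinHelper≡ : ∀ m k → sinHelper m k ≡ sinNum m * invFact k
sinHelper≡ zero          k = sym (QP.*-zeroˡ (invFact k))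
sinHelper≡ (suc zero)    k = sym (QP.*-identityˡ (invFact k))
sinHelper≡ (suc (suc m)) k = trans (cong -_ (sinHelper≡ m k)) (QP.neg-distribˡ-* (sinNum m) (invFact k))

cosPS≡ : ∀ n → cosPS n ≡ cosNum n * invFact n
cosPS≡ n = cosHelper≡ n n

sinPS≡ : ∀ n → sinPS n ≡ sinNum n * invFact n
sinPS≡ n = sinHelper≡ n n

egf-invFact : ∀ c n → ι (n !) * (c * invFact n) ≡ c
egf-invFact c n = begin
  ι (n !) * (c * invFact n)      ≡⟨ solve 3 (λ a c b → a :* (c :* b) := c :* (a :* b)) refl (ι (n !)) c (invFact n) ⟩
  c * (ι (n !) * invFact n)      ≡⟨ cong (c *_) (ι-*-inverse (n !) {{n !≢0}}) ⟩
  c * 1ℚ                         ≡⟨ QP.*-identityʳ c ⟩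
  c                              ∎

egf-cosPS : ∀ n → egf cosPS n ≡ cosNum n
egf-cosPS n = trans (cong (ι (n !) *_) (cosPS≡ n)) (egf-invFact (cosNum n) n)

egf-sinPS : ∀ n → egf sinPS n ≡ sinNum n
egf-sinPS n = trans (cong (ι (n !) *_) (sinPS≡ n)) (egf-invFact (sinNum n) n)

secNum tanNum : ℕ → ℚ
secNum = egf secPS
tanNum = egf tanPS

cosNum⊛secNum : ∀ n → ∑ (2 ℕ.+ n) (λ k → ι (suc n C k) * cosNum k * secNum (suc n ∸ k)) ≡ 0ℚ
cosNum⊛secNum n = begin
  ∑ (2 ℕ.+ n) (λ k → ι (suc n C k) * cosNum k * secNum (suc n ∸ k))
    ≡⟨ ∑-cong (2 ℕ.+ n) (λ k _ → cong (λ c → ι (suc n C k) * c * secNum (suc n ∸ k)) (egf-cosPS k)) ⟨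
  ∑ (2 ℕ.+ n) (λ k → ι (suc n C k) * egf cosPS k * secNum (suc n ∸ k))
    ≡⟨ egf-⊗ cosPS secPS (suc n) ⟨
  ι (suc n !) * (cosPS ⊗ secPS) (suc n)
    ≡⟨ cong (ι (suc n !) *_) (⊗-inv₁ cosPS (QP.*-identityˡ 1ℚ) n) ⟩
  ι (suc n !) * 0ℚ
    ≡⟨ QP.*-zeroʳ (ι (suc n !)) ⟩
  0ℚ ∎

tanNum≡ : ∀ n → tanNum n ≡ ∑ (suc n) (λ k → ι (n C k) * sinNum k * secNum (n ∸ k))
tanNum≡ n = trans (egf-⊗ sinPS secPS n)
  (∑-cong (suc n) (λ k _ → cong (λ s → ι (n C k) * s * secNum (n ∸ k)) (egf-sinPS k)))

coefficient : ℕ → ℕ → ℕ → ℚ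
coefficient k d i = ι (k C i) * sinNum i + ι (d C i) * cosNum i

coefficient-pascal : ∀ t d j → coefficient (suc t) d (suc j) ≡ coefficient t (suc d) (suc j) + coefficient d t j
coefficient-pascal t d j = begin
  coefficient (suc t) d (suc j)
    ≡⟨ cong₂ _+_ (cong₂ _*_ (pascal t) (sinNum-suc j)) (cong (ι (d C suc j) *_) (cosNum-suc j)) ⟩
  (a + b) * x + q * (- y)
    ≡⟨ solve 6 (λ a b p q x y → (a :+ b) :* x :+ q :* (:- y) := (b :* x :+ (p :+ q) :* (:- y)) :+ (p :* y :+ a :* x))
             refl a b p q x y ⟩
  (b * x + (p + q) * (- y)) + (p * y + a * x)
    ≡⟨ cong (_+ (p * y + a * x)) (cong₂ _+_ (cong (b *_) (sinNum-suc j)) (cong₂ _*_ (pascal d) (cosNum-suc j))) ⟨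
  coefficient t (suc d) (suc j) + coefficient d t j ∎
  where
  pascal : ∀ n → ι (suc n C suc j) ≡ ι (n C j) + ι (n C suc j)
  pascal n = trans (cong ι (sym (nCk+nC[k+1]≡[n+1]C[k+1] n j))) (ι-+ (n C j) (n C suc j))
  a b p q x y : ℚ
  a = ι (t C j)
  b = ι (t C suc j)
  p = ι (d C j)
  q = ι (d C suc j)
  x = cosNum j
  y = sinNum j

-- row n k (n ∸ k) is the closed form of the Entringer number e(n, k); keeping n ∸ k as a separate
-- argument lets Pascal's rule act on both binomial coefficients independently.
row : ℕ → ℕ → ℕ → ℚ
row n k d = ∑ (suc n) (λ i → coefficient k d i * secNum (n ∸ i))

row-pascal : ∀ q t d → row (suc q) (suc t) d ≡ row (suc q) t (suc d) + row q d t
row-pascal q t d = begin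
  x₀ + ∑ (suc q) (λ j → coefficient (suc t) d (suc j) * S j)
    ≡⟨ cong (x₀ +_) (∑-cong (suc q) (λ j _ → trans (cong (_* S j) (coefficient-pascal t d j))
                                                   (QP.*-distribʳ-+ (S j) (coefficient t (suc d) (suc j)) (coefficient d t j)))) ⟩
  x₀ + ∑ (suc q) (λ j → coefficient t (suc d) (suc j) * S j + coefficient d t j * S j)
    ≡⟨ cong (x₀ +_) (∑-+ (suc q) (λ j → coefficient t (suc d) (suc j) * S j) (λ j → coefficient d t j * S j)) ⟩
  x₀ + (∑ (suc q) (λ j → coefficient t (suc d) (suc j) * S j) + ∑ (suc q) (λ j → coefficient d t j * S j))
    ≡⟨ QP.+-assoc x₀ _ _ ⟨
  row (suc q) t (suc d) + row q d t ∎
  where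
  S : ℕ → ℚ
  S j = secNum (q ∸ j)
  x₀ : ℚ
  x₀ = coefficient (suc t) d 0 * secNum (suc q)

entringer : ℕ → ℕ → ℚ
entringer n k = row n k (n ∸ k)

isEntringer : IsEntringer entringer
isEntringer = record { zero-zero = zero-zero ; suc-zero = suc-zero ; suc-suc = suc-suc }
  where
  zero-zero : entringer 0 0 ≡ 1ℚ
  zero-zero = refl

  sin-term-vanishes : ∀ i x → ι (0 C i) * sinNum i * x ≡ 0ℚ
  sin-term-vanishes zero    x = trans (cong (_* x) (QP.*-zeroʳ (ι 1))) (QP.*-zeroˡ x)
  sin-term-vanishes (suc i) x = trans (cong (_* x) (QP.*-zeroˡ (sinNum (suc i)))) (QP.*-zeroˡ x)

  suc-zero : ∀ n → entringer (suc n) 0 ≡ 0ℚ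
  suc-zero n = begin
    ∑ (2 ℕ.+ n) (λ i → coefficient 0 (suc n) i * secNum (suc n ∸ i))
      ≡⟨ ∑-cong (2 ℕ.+ n) (λ i _ → cos-term i) ⟩
    ∑ (2 ℕ.+ n) (λ i → ι (suc n C i) * cosNum i * secNum (suc n ∸ i))
      ≡⟨ cosNum⊛secNum n ⟩
    0ℚ ∎
    where
    cos-term : ∀ i → coefficient 0 (suc n) i * secNum (suc n ∸ i) ≡ ι (suc n C i) * cosNum i * secNum (suc n ∸ i)
    cos-term i = begin
      coefficient 0 (suc n) i * S
        ≡⟨ QP.*-distribʳ-+ S (ι (0 C i) * sinNum i) (ι (suc n C i) * cosNum i) ⟩
      ι (0 C i) * sinNum i * S + ι (suc n C i) * cosNum i * S
        ≡⟨ cong (_+ ι (suc n C i) * cosNum i * S) (sin-term-vanishes i S) ⟩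
      0ℚ + ι (suc n C i) * cosNum i * S
        ≡⟨ QP.+-identityˡ _ ⟩
      ι (suc n C i) * cosNum i * S ∎
      where
      S : ℚ
      S = secNum (suc n ∸ i)

  suc-suc : ∀ n k → k ℕ.≤ n → entringer (suc n) (suc k) ≡ entringer (suc n) k + entringer n (n ∸ k)
  suc-suc n k k≤n = begin
    row (suc n) (suc k) (n ∸ k)                        ≡⟨ row-pascal n k (n ∸ k) ⟩
    row (suc n) k (suc (n ∸ k)) + row n (n ∸ k) k      ≡⟨ cong₂ (λ a b → row (suc n) k a + row n (n ∸ k) b)
                                                                (sym (NP.+-∸-assoc 1 k≤n)) (sym (NP.m∸[m∸n]≡n k≤n)) ⟩
    row (suc n) k (suc n ∸ k) + row n (n ∸ k) (n ∸ (n ∸ k)) ∎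

zigzag : ℕ → ℚ
zigzag = egf (secPS ⊕ tanPS)

egf-⊕ : ∀ (f g : PS) n → egf (f ⊕ g) n ≡ egf f n + egf g n
egf-⊕ f g n = QP.*-distribˡ-+ (ι (n !)) (f n) (g n)

entringer-diagonal : ∀ n → entringer n n ≡ zigzag n
entringer-diagonal n = begin
  row n n (n ∸ n)
    ≡⟨ cong (row n n) (NP.n∸n≡0 n) ⟩
  ∑ (suc n) (λ i → coefficient n 0 i * S i)
    ≡⟨ ∑-cong (suc n) (λ i _ → QP.*-distribʳ-+ (S i) (ι (n C i) * sinNum i) (ι (0 C i) * cosNum i)) ⟩
  ∑ (suc n) (λ i → ι (n C i) * sinNum i * S i + ι (0 C i) * cosNum i * S i)
    ≡⟨ ∑-+ (suc n) (λ i → ι (n C i) * sinNum i * S i) (λ i → ι (0 C i) * cosNum i * S i) ⟩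
  ∑ (suc n) (λ i → ι (n C i) * sinNum i * S i) + ∑ (suc n) (λ i → ι (0 C i) * cosNum i * S i)
    ≡⟨ cong₂ _+_ (sym (tanNum≡ n)) cos-side ⟩
  tanNum n + secNum n
    ≡⟨ QP.+-comm (tanNum n) (secNum n) ⟩
  secNum n + tanNum n
    ≡⟨ egf-⊕ secPS tanPS n ⟨
  egf (secPS ⊕ tanPS) n ∎
  where
  S : ℕ → ℚ
  S i = secNum (n ∸ i)

  cos-side : ∑ (suc n) (λ i → ι (0 C i) * cosNum i * S i) ≡ secNum n
  cos-side = begin
    x₀ + ∑ n (λ j → ι (0 C suc j) * cosNum (suc j) * S (suc j))
      ≡⟨ cong (x₀ +_) (trans (∑-cong n (λ j _ → trans (cong (_* S (suc j)) (QP.*-zeroˡ (cosNum (suc j))))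
                                                      (QP.*-zeroˡ (S (suc j)))))
                             (∑-zero n)) ⟩
    x₀ + 0ℚ
      ≡⟨ solve 1 (λ s → (con 1ℚ :+ con 0ℚ) :* con 1ℚ :* s :+ con 0ℚ := s) refl (secNum n) ⟩
    secNum n ∎
    where
    x₀ : ℚ
    x₀ = ι (0 C 0) * cosNum 0 * secNum n

⊗-linear : ∀ (p g : PS) → (∀ k → p (2 ℕ.+ k) ≡ 0ℚ) → ∀ n → (p ⊗ g) (suc n) ≡ p 0 * g (suc n) + p 1 * g n
⊗-linear p g p≥2≡0 n = begin
  (p ⊗ g) (suc n)
    ≡⟨ ⊗-∑ p g (suc n) ⟩
  p 0 * g (suc n) + (p 1 * g n + ∑ n (λ k → p (2 ℕ.+ k) * g (n ∸ suc k)))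
    ≡⟨ cong (λ s → p 0 * g (suc n) + (p 1 * g n + s)) (trans (∑-cong n (λ k _ → trans (cong (_* g (n ∸ suc k)) (p≥2≡0 k))
                                                                                       (QP.*-zeroˡ (g (n ∸ suc k)))))
                                                              (∑-zero n)) ⟩
  p 0 * g (suc n) + (p 1 * g n + 0ℚ)
    ≡⟨ cong (p 0 * g (suc n) +_) (QP.+-identityʳ (p 1 * g n)) ⟩
  p 0 * g (suc n) + p 1 * g n ∎

F-egf : ∀ M → egf F (2 ℕ.+ M)
  ≡ (zigzag (2 ℕ.+ M) + zigzag (2 ℕ.+ M)) - ι (suc M) * zigzag (suc M) - ι (suc M) * zigzag M
F-egf M = begin
  ι ((2 ℕ.+ M) !) * F (2 ℕ.+ M)
    ≡⟨ cong₂ (λ u v → ι ((2 ℕ.+ M) !) * (u - v * r)) (⊗-linear A Y (λ _ → refl) (suc M)) (⊗-linear B Y (λ _ → refl) M) ⟩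
  ι ((2 ℕ.+ M) !) * ((A 0 * y₂ + A 1 * y₁) - (B 0 * y₁ + B 1 * y₀) * r)
    ≡⟨ cong (_* ((A 0 * y₂ + A 1 * y₁) - (B 0 * y₁ + B 1 * y₀) * r)) fact₂ ⟩
  f₂ * (((1ℚ + 1ℚ) * y₂ + (- 1ℚ) * y₁) - ((- 1ℚ) * y₁ + 1ℚ * y₀) * r)
    ≡⟨ solve 6 (λ a P y₀ y₁ y₂ r →
              ((con 1ℚ :+ a) :* (a :* P))
                :* (((con 1ℚ :+ con 1ℚ) :* y₂ :+ (:- con 1ℚ) :* y₁) :- ((:- con 1ℚ) :* y₁ :+ con 1ℚ :* y₀) :* r)
           := ((con 1ℚ :+ a) :* (a :* P)) :* ((con 1ℚ :+ con 1ℚ) :* y₂ :- y₁)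
              :- (a :* P :* (y₀ :- y₁)) :* ((con 1ℚ :+ a) :* r))
         refl a P y₀ y₁ y₂ r ⟩
  f₂ * ((1ℚ + 1ℚ) * y₂ - y₁) - (a * P * (y₀ - y₁)) * ((1ℚ + a) * r)
    ≡⟨ cong (λ u → f₂ * ((1ℚ + 1ℚ) * y₂ - y₁) - (a * P * (y₀ - y₁)) * u) (ι-*-inverse (2 ℕ.+ M)) ⟩
  f₂ * ((1ℚ + 1ℚ) * y₂ - y₁) - (a * P * (y₀ - y₁)) * 1ℚ
    ≡⟨ solve 5 (λ a P y₀ y₁ y₂ →
              ((con 1ℚ :+ a) :* (a :* P)) :* ((con 1ℚ :+ con 1ℚ) :* y₂ :- y₁) :- (a :* P :* (y₀ :- y₁)) :* con 1ℚ
           := (((con 1ℚ :+ a) :* (a :* P)) :* y₂ :+ ((con 1ℚ :+ a) :* (a :* P)) :* y₂)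
              :- a :* ((a :* P) :* y₁) :- a :* (P :* y₀))
         refl a P y₀ y₁ y₂ ⟩
  (f₂ * y₂ + f₂ * y₂) - a * ((a * P) * y₁) - a * (P * y₀)
    ≡⟨ cong₂ (λ u v → (u * y₂ + u * y₂) - a * (v * y₁) - a * (P * y₀)) (sym fact₂) (sym fact₁) ⟩
  (zigzag (2 ℕ.+ M) + zigzag (2 ℕ.+ M)) - a * zigzag (suc M) - a * zigzag M ∎
  where
  Y A B : PS
  Y = secPS ⊕ tanPS
  A = const (ℤ.+ 2 / 1) ⊖ X
  B = X ⊖ const 1ℚ
  y₀ y₁ y₂ a P r : ℚ
  y₀ = Y M
  y₁ = Y (suc M)
  y₂ = Y (2 ℕ.+ M)
  a = ι (suc M)
  P = ι (M !)
  r = ℤ.+ 1 / (2 ℕ.+ M)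
  fact₁ : ι (suc M !) ≡ a * P
  fact₁ = ι-* (suc M) (M !)
  f₂ : ℚ
  f₂ = (1ℚ + a) * (a * P)
  fact₂ : ι ((2 ℕ.+ M) !) ≡ f₂
  fact₂ = trans (ι-* (2 ℕ.+ M) (suc M !)) (cong (ι (2 ℕ.+ M) *_) fact₁)

countA-zigzag : ∀ m → ι (countA (3 ℕ.+ m))
  ≡ (zigzag (3 ℕ.+ m) + zigzag (3 ℕ.+ m)) - ι (2 ℕ.+ m) * zigzag (2 ℕ.+ m) - ι (2 ℕ.+ m) * zigzag (suc m)
countA-zigzag m = begin
  ι (countA (3 ℕ.+ m))
    ≡⟨ Entringer.Diagonal.countA-entringer isEntringer m ⟩
  (e₃ + e₃) - c * e₂ - c * e₁
    ≡⟨ cong₂ (λ x y → (x + x) - c * y - c * e₁) (entringer-diagonal (3 ℕ.+ m)) (entringer-diagonal (2 ℕ.+ m)) ⟩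
  (zigzag (3 ℕ.+ m) + zigzag (3 ℕ.+ m)) - c * zigzag (2 ℕ.+ m) - c * e₁
    ≡⟨ cong (λ z → (zigzag (3 ℕ.+ m) + zigzag (3 ℕ.+ m)) - c * zigzag (2 ℕ.+ m) - c * z)
            (entringer-diagonal (suc m)) ⟩
  (zigzag (3 ℕ.+ m) + zigzag (3 ℕ.+ m)) - c * zigzag (2 ℕ.+ m) - c * zigzag (suc m) ∎
  where
  c e₁ e₂ e₃ : ℚ
  c  = ι (2 ℕ.+ m)
  e₁ = entringer (suc m) (suc m)
  e₂ = entringer (2 ℕ.+ m) (2 ℕ.+ m)
  e₃ = entringer (3 ℕ.+ m) (3 ℕ.+ m)

open import Data.Integer.Base using (+_)

mainTheorem6 : (n : ℕ) → n ≥ 3 →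
    (+ countA n) / 1 ≡ ((+ (n !)) / 1) * coeff n F
mainTheorem6 (suc (suc (suc m))) (ℕ.s≤s (ℕ.s≤s (ℕ.s≤s _))) = begin
  (+ countA (3 ℕ.+ m)) / 1
    ≡⟨ ι≡/1 (countA (3 ℕ.+ m)) ⟨
  ι (countA (3 ℕ.+ m))
    ≡⟨ countA-zigzag m ⟩
  (zigzag (3 ℕ.+ m) + zigzag (3 ℕ.+ m)) - ι (2 ℕ.+ m) * zigzag (2 ℕ.+ m) - ι (2 ℕ.+ m) * zigzag (suc m)
    ≡⟨ F-egf (suc m) ⟨
  ι ((3 ℕ.+ m) !) * F (3 ℕ.+ m)
    ≡⟨ cong (_* F (3 ℕ.+ m)) (ι≡/1 ((3 ℕ.+ m) !)) ⟩
  ((+ ((3 ℕ.+ m) !)) / 1) * coeff (3 ℕ.+ m) F ∎
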